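{- Let $\Sigma$ be a finite set and let $\mathcal R$ be the family of regular safety constraints, i.e. of all sets $\mathcal C_a(x)$ where $a$ is a $\Sigma$-detector with finite carrier and $x$ is in its carrier. Then $\mathcal R$ is a family with a universal detector: there exists a $\Sigma$-detector $b$ with carrier $B$ such that $\mathcal R=\{\mathcal C_b(y)\mid y\in B\}$.
   Context: $\Sigma^{\mathbb N}$ is the set of streams over $\Sigma$; $\mathbf 1=\{\Downarrow\}$, $+$ disjoint union; $s[m:]$ is the sequence $k\mapsto s(k+m)$. A $\Sigma$-detector is a map $a:A\to(\mathbf 1+A)^\Sigma$ ($A$ its carrier). For a stream $s$, $[s]$ is the system with state set $\{s[k:]\mid k\in\mathbb N\}$, output $t\mapsto t(0)$ and transition $t\mapsto t[1:]$. For such a system $\sigma=\langle\mathrm{out}_\sigma,\mathrm{tr}_\sigma\rangle$ and a detector $a$, $\mathrm{Join}(\sigma,a)(x,y)=\Downarrow$ if $a(y)(\mathrm{out}_\sigma x)=\Downarrow$ and $(\mathrm{tr}_\sigma x,a(y)(\mathrm{out}_\sigma x))$ otherwise. Iterates of $g:G\to\mathbf 1+G$: $g^{(1)}=g$, $g^{(k+1)}(x)=\Downarrow$ if $g^{(k)}(x)=\Downarrow$, else $g(g^{(k)}(x))$. $\mathcal C_a(x)=\{s\in\Sigma^{\mathbb N}\mid \mathrm{Join}([s],a)^{(k)}(s,x)\ne\Downarrow\text{ for all }k\ge1\}$. -}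

module Defs where

open import Data.Nat using (ℕ; zero; suc; _+_)
open import Data.Fin using (Fin)
open import Data.Nat.Properties using (+-assoc; +-identityʳ)
open import Data.Unit using (⊤; tt)
open import Data.Sum using (_⊎_; inj₁; inj₂)
open import Data.Product using (Σ; ∃; _,_; proj₁; proj₂)
open import Relation.Binary.PropositionalEquality using (_≡_; refl; cong; trans; sym)
open import Relation.Nullary using (¬_)
open import Function.Bundles using (_↔_; _⇔_)

-- 𝟏 = {⇓}, rendered as ⊤ with ⇓ = tt; 𝟏 + X is ⊤ ⊎ X.
⇓ : ⊤
⇓ = tt

Finite : Set → Set
Finite A = Σ ℕ λ n → A ↔ Fin n

Stream : Set → Set
Stream S = ℕ → S

shift : {S : Set} → Stream S → ℕ → Stream S
shift s m = λ k → s (k + m)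

Detector : Set → Set → Set
Detector S A = A → S → ⊤ ⊎ A

+-suc-1 : ∀ j k → (j + 1) + k ≡ j + suc k
+-suc-1 j k = trans (+-assoc j 1 k) refl

record System (S X : Set) : Set where
  field
    out : X → S
    tr  : X → X
open System public

-- State set of [s]: { s[k:] | k ∈ ℕ }  (stream equality taken pointwise,
-- since function extensionality is unavailable).
Suffix : {S : Set} → Stream S → Set
Suffix {S} s = Σ (Stream S) λ t → ∃ λ k → ∀ j → t j ≡ shift s k j

⟦_⟧ : {S : Set} → (s : Stream S) → System S (Suffix s)
⟦ s ⟧ = record
  { out = λ p → proj₁ p 0
  ; tr  = λ { (t , k , eq) → shift t 1 , suc k , λ j → trans (eq (j + 1)) (cong s (+-suc-1 j k)) }
  }

Join : {S X A : Set} → System S X → Detector S A → (Σ X λ _ → A) → ⊤ ⊎ (Σ X λ _ → A)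
Join σ a (x , y) with a y (out σ x)
... | inj₁ _  = inj₁ ⇓
... | inj₂ y′ = inj₂ (tr σ x , y′)

-- Iterates: iter g (suc k) = g^(k+1); iter g 0 is the identity (auxiliary only).
iter : {G : Set} → (G → ⊤ ⊎ G) → ℕ → G → ⊤ ⊎ G
iter g zero x = inj₂ x
iter g (suc k) x with iter g k x
... | inj₁ _ = inj₁ ⇓
... | inj₂ x′ = g x′

start : {S : Set} → (s : Stream S) → Suffix s
start s = s , 0 , λ j → cong s (sym (+-identityʳ j))

𝒞 : {S A : Set} → Detector S A → A → Stream S → Set
𝒞 a x s = ∀ k → ¬ (iter (Join ⟦ s ⟧ a) (suc k) (start s , x) ≡ inj₁ ⇓)

_≐_ : {S : Set} → (Stream S → Set) → (Stream S → Set) → Set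
P ≐ Q = ∀ s → P s ⇔ Q s

module Submission where

-- Call h : A → A' a morphism of detectors a, a' if stepping
-- a' from h y on a letter does the same as stepping a from y and then
-- applying h (halting being preserved).  A morphism turns every run of
-- Join([s], a) into a run of Join([s], a'), step by step, and halts
-- exactly when the original does; hence 𝒞 a x ≐ 𝒞 a' (h x).
--
-- The universal detector b has as states the triples (n, d, i) of a
-- detector d on Fin n together with a state i; it simply runs d from i.
-- For each fixed (n, d) the map i ↦ (n, d, i) is a morphism d → b, so
-- every constraint of b is regular and every constraint of a detector on
-- some Fin n is one of b.  A detector with finite carrier A ↔ Fin n is
-- transported along the bijection to a detector on Fin n, the bijection
-- being a morphism; composing the two morphisms proves the theorem.

open import Defs
open import Data.Product using (Σ; ∃; _×_; _,_)
open import Data.Sum using (_⊎_; inj₁; inj₂; map₂)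
open import Data.Unit using (⊤; tt)
open import Data.Nat using (ℕ; zero; suc)
open import Data.Fin using (Fin)
open import Relation.Binary.PropositionalEquality using (_≡_; refl; sym; trans)
open import Function.Bundles using (_↔_; Inverse; mk⇔)
open import Function.Properties.Inverse using (↔-refl)
import Function.Properties.Equivalence as ⇔

map₂-halts : {G G' : Set} (f : G → G') (u : ⊤ ⊎ G) → map₂ f u ≡ inj₁ ⇓ → u ≡ inj₁ ⇓
map₂-halts f (inj₁ tt) _ = refl

halts-map₂ : {G G' : Set} (f : G → G') (u : ⊤ ⊎ G) → u ≡ inj₁ ⇓ → map₂ f u ≡ inj₁ ⇓
halts-map₂ f (inj₁ tt) _ = refl

iter-intertwine : {G G' : Set} (g : G → ⊤ ⊎ G) (g' : G' → ⊤ ⊎ G') (H : G → G') →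
  (∀ p → g' (H p) ≡ map₂ H (g p)) →
  ∀ k p → iter g' k (H p) ≡ map₂ H (iter g k p)
iter-intertwine g g' H square zero p = refl
iter-intertwine g g' H square (suc k) p rewrite iter-intertwine g g' H square k p
  with iter g k p
... | inj₁ _ = refl
... | inj₂ q = square q

IsMorphism : {S A A' : Set} → Detector S A → Detector S A' → (A → A') → Set
IsMorphism {S} {A} a a' h = ∀ (y : A) (c : S) → a' (h y) c ≡ map₂ h (a y c)

onDetector : {X A A' : Set} → (A → A') → (Σ X λ _ → A) → (Σ X λ _ → A')
onDetector h (x , y) = x , h y

join-intertwine : {S X A A' : Set} (σ : System S X)
  (a : Detector S A) (a' : Detector S A') (h : A → A') → IsMorphism a a' h →
  ∀ (p : Σ X λ _ → A) → Join σ a' (onDetector h p) ≡ map₂ (onDetector h) (Join σ a p)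
join-intertwine σ a a' h hom (x , y) rewrite hom y (out σ x) with a y (out σ x)
... | inj₁ _ = refl
... | inj₂ _ = refl

morphism-preserves-𝒞 : {S A A' : Set} (a : Detector S A) (a' : Detector S A')
  (h : A → A') → IsMorphism a a' h → (x : A) → 𝒞 a x ≐ 𝒞 a' (h x)
morphism-preserves-𝒞 a a' h hom x s = mk⇔
  (λ safe k halt → safe k (map₂-halts (onDetector h) _ (trans (sym (runs k)) halt)))
  (λ safe k halt → safe k (trans (runs k) (halts-map₂ (onDetector h) _ halt)))
  where
  runs : ∀ k → iter (Join ⟦ s ⟧ a') (suc k) (start s , h x)
             ≡ map₂ (onDetector h) (iter (Join ⟦ s ⟧ a) (suc k) (start s , x))
  runs k = iter-intertwine _ _ (onDetector h) (join-intertwine ⟦ s ⟧ a a' h hom)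
             (suc k) (start s , x)

≐-sym : {S : Set} {P Q : Stream S → Set} → P ≐ Q → Q ≐ P
≐-sym P≐Q s = ⇔.sym (P≐Q s)

≐-trans : {S : Set} {P Q R : Stream S → Set} → P ≐ Q → Q ≐ R → P ≐ R
≐-trans P≐Q Q≐R s = ⇔.trans (P≐Q s) (Q≐R s)

transport : {S A : Set} {n : ℕ} → A ↔ Fin n → Detector S A → Detector S (Fin n)
transport f a j c = map₂ (Inverse.to f) (a (Inverse.from f j) c)

transport-morphism : {S A : Set} {n : ℕ} (f : A ↔ Fin n) (a : Detector S A) →
  IsMorphism a (transport f a) (Inverse.to f)
transport-morphism f a y c rewrite Inverse.strictlyInverseʳ f y = refl

Universal : Set → Set
Universal S = Σ ℕ λ n → Σ (Detector S (Fin n)) λ _ → Fin n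

universal : (S : Set) → Detector S (Universal S)
universal S (n , d , i) c = map₂ (λ j → n , d , j) (d i c)

embed-morphism : {S : Set} {n : ℕ} (d : Detector S (Fin n)) →
  IsMorphism d (universal S) (λ i → n , d , i)
embed-morphism d i c = refl

theorem6 : (S : Set) → Finite S →
    Σ Set λ B → Σ (Detector S B) λ b →
    ((A : Set) → Finite A → (a : Detector S A) → (x : A) →
    ∃ λ y → 𝒞 a x ≐ 𝒞 b y)
    × ((y : B) →
    Σ Set λ A → Finite A × Σ (Detector S A) λ a → ∃ λ x → 𝒞 b y ≐ 𝒞 a x)
theorem6 S _ = Universal S , universal S , regular⇒universal , universal⇒regular
  where
  regular⇒universal : (A : Set) → Finite A → (a : Detector S A) → (x : A) →
    ∃ λ y → 𝒞 a x ≐ 𝒞 (universal S) y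
  regular⇒universal A (n , f) a x = (n , transport f a , Inverse.to f x) ,
    ≐-trans (morphism-preserves-𝒞 a (transport f a) (Inverse.to f) (transport-morphism f a) x)
            (morphism-preserves-𝒞 (transport f a) (universal S) _ (embed-morphism (transport f a))
               (Inverse.to f x))

  universal⇒regular : (y : Universal S) →
    Σ Set λ A → Finite A × Σ (Detector S A) λ a → ∃ λ x → 𝒞 (universal S) y ≐ 𝒞 a x
  universal⇒regular (n , d , i) = Fin n , (n , ↔-refl) , d , i ,
    ≐-sym (morphism-preserves-𝒞 d (universal S) _ (embed-morphism d) i)
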